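{- Let $n,a\in\mathbb{N}$ with $\gcd(a,L(n))=1$. Then \[ \operatorname{lev}_n(a)=\min\{\nu: \operatorname{ord}_n^{(\nu)}(a)=1\}-1=\min\{\nu:\operatorname{ord}_n^{(\nu)}(a)\mid a-1\}. \]
   Context: Tetration: ${}^0a=1$, ${}^ka=a^{({}^{k-1}a)}$. $\lambda$ is Carmichael's function, $\lambda^{(0)}(n)=n$, $\lambda^{(k)}=\lambda\circ\lambda^{(k-1)}$, $H(n)=\min\{\alpha:\lambda^{(\alpha)}(n)=1\}$, $L(n)=\operatorname{lcm}\{n,\lambda(n),\dots,\lambda^{(H(n))}(n)\}$. $\operatorname{lev}_n(a)$ is the least $t\ge0$ with ${}^ka\equiv{}^ta\pmod n$ for all $k\ge t$. $V(a,n)$ is the largest divisor of $n$ coprime to $a$. Iterated orders: $\operatorname{ord}_n^{(0)}(a)=n$ and $\operatorname{ord}_n^{(k)}(a)=\operatorname{ord}_{V(a,\operatorname{ord}_n^{(k-1)}(a))}(a)$ for $k\in\mathbb{N}$, where $\operatorname{ord}_m(a)$ is the multiplicative order of $a$ modulo $m$ (with $\operatorname{ord}_1(a)=1$). The minima range over $\nu\in\mathbb{N}_0$. -}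

module Defs where

open import Data.Nat using (ℕ; zero; suc; _+_; _*_; _∸_; _^_; _≤_; _≡ᵇ_; NonZero)
open import Data.Nat.DivMod using (_%_)
open import Data.Nat.GCD using (gcd)
open import Data.Nat.LCM using (lcm)
open import Data.Nat.Divisibility using (_∣?_)
open import Data.Bool using (Bool; true; false; if_then_else_; _∧_; _∨_; not)
open import Data.List using (List; []; _∷_; map; foldr; upTo)
open import Data.Product using (_×_)
open import Relation.Nullary using (does)
open import Relation.Binary.PropositionalEquality using (_≡_)

IsLeast : (ℕ → Set) → ℕ → Set
IsLeast P m = P m × (∀ k → P k → m ≤ k)

-- Bounded minimisation: the least i < b with p i ≡ true, or b if none.
leastBelow : ℕ → (ℕ → Bool) → ℕ
leastBelow zero    p = zero
leastBelow (suc b) p = if p zero then zero else suc (leastBelow b (λ i → p (suc i)))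

tet : ℕ → ℕ → ℕ
tet a zero    = 1
tet a (suc k) = a ^ tet a k

iter : (ℕ → ℕ) → ℕ → ℕ → ℕ
iter f zero    x = x
iter f (suc k) x = f (iter f k x)

-- Carmichael's function: λ(n) = least m ≥ 1 with a^m ≡ 1 (mod n) for every a
-- coprime to n (it suffices to range over residues a < n).  The search
-- ranges over m ∈ [1, n], which always contains λ(n) (λ(n) ≤ φ(n) ≤ n).
-- λ(0) is never used; we set it to 0.
carmichaelExp? : ℕ → ℕ → Bool
carmichaelExp? zero    m = false
carmichaelExp? (suc k) m =
  foldr _∧_ true (map (λ a → not (gcd a (suc k) ≡ᵇ 1) ∨ (a ^ m % suc k ≡ᵇ 1 % suc k)) (upTo (suc k)))

carmichael : ℕ → ℕ
carmichael zero    = zero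
carmichael (suc k) = suc (leastBelow (suc k) (λ i → carmichaelExp? (suc k) (suc i)))

-- H(n) = min{α : λ^(α)(n) = 1}; for n ≥ 1 this is at most n.
H : ℕ → ℕ
H n = leastBelow (suc n) (λ α → iter carmichael α n ≡ᵇ 1)

L : ℕ → ℕ
L n = foldr lcm 1 (map (λ i → iter carmichael i n) (upTo (suc (H n))))

-- V(a,n) = largest divisor of n coprime to a (searched downward from n; 1 always qualifies).
V : ℕ → ℕ → ℕ
V a n = n ∸ leastBelow n (λ i → does ((n ∸ i) ∣? n) ∧ (gcd (n ∸ i) a ≡ᵇ 1))

-- ord_m(a) = multiplicative order of a modulo m (for gcd(a,m) = 1; ord_1(a) = 1),
-- searched in [1, m], which contains it (ord_m(a) ≤ φ(m) ≤ m).  ord_0 is never used.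
ord : ℕ → ℕ → ℕ
ord zero    a = zero
ord (suc k) a = suc (leastBelow (suc k) (λ i → a ^ suc i % suc k ≡ᵇ 1 % suc k))

ordIt : ℕ → ℕ → ℕ → ℕ
ordIt n a zero    = n
ordIt n a (suc k) = ord (V a (ordIt n a k)) a

-- The property whose least witness is lev_n(a): ᵏa ≡ ᵗa (mod n) for all k ≥ t.
LevProp : (n : ℕ) → .{{NonZero n}} → ℕ → ℕ → Set
LevProp n a t = ∀ k → t ≤ k → tet a k % n ≡ tet a t % n

{-# OPTIONS --safe #-}
module Submission where

-- Since a is coprime to L(n), it is coprime to every iterate λ⁽ᵏ⁾(n), and by induction
-- ord⁽ᵏ⁾ ∣ λ⁽ᵏ⁾(n); so V(a, ·) never removes anything and ord⁽ᵏ⁺¹⁾ = ord_{ord⁽ᵏ⁾}(a).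
-- As a ^ x ≡ a ^ y (mod ord⁽ᵏ⁾) iff x ≡ y (mod ord⁽ᵏ⁺¹⁾), induction on t gives
-- ᵗ⁺ˣa ≡ ᵗ⁺ʸa (mod n) iff ˣa ≡ ʸa (mod ord⁽ᵗ⁾).  Hence the tower is constant modulo n
-- from height t exactly when a ≡ 1 (mod ord⁽ᵗ⁾), i.e. ord⁽ᵗ⁾ ∣ a − 1, i.e. ord⁽ᵗ⁺¹⁾ = 1,
-- and the three minima differ by the shift ν ↦ ν + 1.  The minima exist because
-- λ(m) < m for m ≥ 2 (Euler's theorem), so λ⁽ᴴ⁽ⁿ⁾⁾(n) = 1 and hence ord⁽ᴴ⁽ⁿ⁾⁾ = 1.

open import Defs
open import Data.Bool using (Bool; true; false; T; not; _∧_; _∨_)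
open import Data.Bool.ListAction using (all)
open import Data.Bool.Properties using (T-∧; T-≡)
open import Data.Empty using (⊥-elim)
open import Data.Fin as Fin using (Fin; toℕ; fromℕ<)
open import Data.Fin.Permutation using (Permutation; permutation)
open import Data.Fin.Properties using (toℕ-fromℕ<; toℕ-injective; toℕ<n)
open import Data.List using ([]; _∷_; foldr; upTo)
open import Data.List.Membership.Propositional using (_∈_)
open import Data.List.Membership.Propositional.Properties using (∈-upTo⁺; ∈-upTo⁻; ∈-map⁺)
import Data.List.Relation.Unary.All as All
open import Data.List.Relation.Unary.All.Properties using (all⁺; all⁻)
open import Data.List.Relation.Unary.Any using (here; there)
open import Data.Nat
open import Data.Nat.Coprimality as Coprimality
  using (Coprime; coprime?; coprime-divisor; coprime-Bézout; coprime⇒gcd≡1; gcd≡1⇒coprime)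
open import Data.Nat.DivMod
open import Data.Nat.Divisibility
open import Data.Nat.GCD as GCD using (gcd)
open import Data.Nat.LCM using (lcm; m∣lcm[m,n]; n∣lcm[m,n])
open import Data.Nat.Properties
open import Data.Nat.Tactic.RingSolver using (solve)
open import Data.Product using (∃; ∃₂; ∃-syntax; _×_; _,_; proj₁; proj₂)
open import Data.Sum using (_⊎_; inj₁; inj₂)
open import Function using (_∘_)
open import Function.Bundles using (_⇔_; mk⇔; Equivalence)
open import Function.Construct.Composition using (_⇔-∘_)
open import Function.Construct.Identity using (⇔-id)
open import Function.Construct.Symmetry using (⇔-sym)
open import Relation.Binary.Bundles using (Setoid)
open import Relation.Binary.PropositionalEquality
open import Relation.Nullary using (¬_; Dec; yes; no)
open import Relation.Nullary.Decidable using (does; isYes; dec-true; toWitness; fromWitness)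
open import Relation.Nullary.Negation using (contradiction)
open import Relation.Unary using (Decidable)

open import Algebra.Properties.CommutativeMonoid.Sum *-1-commutativeMonoid
  using (sum-permute) renaming (sum to ∏)
open import Algebra.Properties.CommutativeMonoid.Sum +-0-commutativeMonoid
  using () renaming (sum to ∑)

private
  variable
    a b c d e j k m n t x y z : ℕ

-- Congruences

infix 4 _≡_modulo_

-- Stated without subtraction or division, so that every modulus, including 0, is allowed.
_≡_modulo_ : ℕ → ℕ → ℕ → Set
x ≡ y modulo m = ∃₂ λ u v → x + u * m ≡ y + v * m

≡⇒mod : x ≡ y → x ≡ y modulo m
≡⇒mod refl = 0 , 0 , refl

mod-refl : x ≡ x modulo m
mod-refl = ≡⇒mod refl

mod-sym : x ≡ y modulo m → y ≡ x modulo m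
mod-sym (u , v , eq) = v , u , sym eq

mod-trans : x ≡ y modulo m → y ≡ c modulo m → x ≡ c modulo m
mod-trans {x = x} {y = y} {m = m} {c = c} (u , v , p) (u′ , v′ , q) = u + u′ , v′ + v , (begin
  x + (u + u′) * m      ≡⟨ solve (x ∷ u ∷ u′ ∷ m ∷ []) ⟩
  (x + u * m) + u′ * m  ≡⟨ cong (_+ u′ * m) p ⟩
  (y + v * m) + u′ * m  ≡⟨ solve (y ∷ v ∷ u′ ∷ m ∷ []) ⟩
  (y + u′ * m) + v * m  ≡⟨ cong (_+ v * m) q ⟩
  (c + v′ * m) + v * m  ≡⟨ solve (c ∷ v′ ∷ v ∷ m ∷ []) ⟩
  c + (v′ + v) * m      ∎)
  where open ≡-Reasoning

modulo-setoid : ℕ → Setoid _ _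
modulo-setoid m = record
  { Carrier       = ℕ
  ; _≈_           = _≡_modulo m
  ; isEquivalence = record { refl = mod-refl ; sym = mod-sym ; trans = mod-trans }
  }

*-cong-mod : a ≡ b modulo m → c ≡ d modulo m → a * c ≡ b * d modulo m
*-cong-mod {a = a} {b = b} {m = m} {c = c} {d = d} (u , v , p) (u′ , v′ , q) =
  a * u′ + u * c + u * u′ * m , b * v′ + v * d + v * v′ * m , (begin
    a * c + (a * u′ + u * c + u * u′ * m) * m  ≡⟨ solve (a ∷ c ∷ u ∷ u′ ∷ m ∷ []) ⟩
    (a + u * m) * (c + u′ * m)                 ≡⟨ cong₂ _*_ p q ⟩
    (b + v * m) * (d + v′ * m)                 ≡⟨ solve (b ∷ d ∷ v ∷ v′ ∷ m ∷ []) ⟩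
    b * d + (b * v′ + v * d + v * v′ * m) * m  ∎)
  where open ≡-Reasoning

^-congˡ-mod : x ≡ y modulo m → ∀ e → x ^ e ≡ y ^ e modulo m
^-congˡ-mod x≡y zero    = mod-refl
^-congˡ-mod x≡y (suc e) = *-cong-mod x≡y (^-congˡ-mod x≡y e)

mod-weaken : d ∣ m → x ≡ y modulo m → x ≡ y modulo d
mod-weaken {d = d} {x = x} {y = y} (divides q refl) (u , v , p) = u * q , v * q , (begin
  x + u * q * d    ≡⟨ cong (x +_) (*-assoc u q d) ⟩
  x + u * (q * d)  ≡⟨ p ⟩
  y + v * (q * d)  ≡⟨ cong (y +_) (*-assoc v q d) ⟨
  y + v * q * d    ∎)
  where open ≡-Reasoning

modulo-1 : x ≡ y modulo 1
modulo-1 {x = x} {y = y} = y , x , (begin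
  x + y * 1  ≡⟨ cong (x +_) (*-identityʳ y) ⟩
  x + y      ≡⟨ +-comm x y ⟩
  y + x      ≡⟨ cong (y +_) (*-identityʳ x) ⟨
  y + x * 1  ∎)
  where open ≡-Reasoning

%-mod : ∀ x m .{{_ : NonZero m}} → x % m ≡ x modulo m
%-mod x m = x / m , 0 , trans (sym (m≡m%n+[m/n]*n x m)) (sym (+-identityʳ x))

mod⇒%≡ : .{{_ : NonZero m}} → x ≡ y modulo m → x % m ≡ y % m
mod⇒%≡ {m = m} {x = x} {y = y} (u , v , p) = begin
  x % m            ≡⟨ [m+kn]%n≡m%n x u m ⟨
  (x + u * m) % m  ≡⟨ cong (_% m) p ⟩
  (y + v * m) % m  ≡⟨ [m+kn]%n≡m%n y v m ⟩
  y % m            ∎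
  where open ≡-Reasoning

%≡⇒mod : .{{_ : NonZero m}} → x % m ≡ y % m → x ≡ y modulo m
%≡⇒mod {m = m} {x = x} {y = y} eq =
  mod-trans (mod-sym (%-mod x m)) (mod-trans (≡⇒mod eq) (%-mod y m))

mod-<⇒≡ : .{{_ : NonZero m}} → x < m → y < m → x ≡ y modulo m → x ≡ y
mod-<⇒≡ x<m y<m x≡y = trans (sym (m<n⇒m%n≡m x<m)) (trans (mod⇒%≡ x≡y) (m<n⇒m%n≡m y<m))

mod⇔∣∸ : y ≤ x → x ≡ y modulo m ⇔ m ∣ x ∸ y
mod⇔∣∸ {y = y} {x = x} {m = m} y≤x = mk⇔ to from
  where
  x≡y+[x∸y] : x ≡ y + (x ∸ y)
  x≡y+[x∸y] = sym (m+[n∸m]≡n y≤x)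
  to : x ≡ y modulo m → m ∣ x ∸ y
  to (u , v , p) = ∣m+n∣m⇒∣n (divides v (+-cancelˡ-≡ y _ _ (begin
    y + (u * m + (x ∸ y))  ≡⟨ cong (y +_) (+-comm (u * m) (x ∸ y)) ⟩
    y + ((x ∸ y) + u * m)  ≡⟨ +-assoc y (x ∸ y) (u * m) ⟨
    y + (x ∸ y) + u * m    ≡⟨ cong (_+ u * m) x≡y+[x∸y] ⟨
    x + u * m              ≡⟨ p ⟩
    y + v * m              ∎))) (n∣m*n u)
    where open ≡-Reasoning
  from : m ∣ x ∸ y → x ≡ y modulo m
  from (divides q eq) = 0 , q , trans (+-identityʳ x) (trans x≡y+[x∸y] (cong (y +_) eq))

mod-wlog-≤ : (R : ℕ → ℕ → Set) → (∀ {x y} → R x y → R y x) →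
             (∀ {x y} → y ≤ x → R x y → x ≡ y modulo m) → R x y → x ≡ y modulo m
mod-wlog-≤ {x = x} {y = y} R R-sym by-≤ r with ≤-total y x
... | inj₁ y≤x = by-≤ y≤x r
... | inj₂ x≤y = mod-sym (by-≤ x≤y (R-sym r))

*-cancelˡ-mod : Coprime m c → c * x ≡ c * y modulo m → x ≡ y modulo m
*-cancelˡ-mod {m = m} {c = c} m⊥c = mod-wlog-≤ (λ x y → c * x ≡ c * y modulo m) mod-sym cancel
  where
  cancel : y ≤ x → c * x ≡ c * y modulo m → x ≡ y modulo m
  cancel {y = y} {x = x} y≤x cx≡cy = Equivalence.from (mod⇔∣∸ y≤x) (coprime-divisor m⊥c
    (subst (m ∣_) (sym (*-distribˡ-∸ c x y)) (Equivalence.to (mod⇔∣∸ (*-monoʳ-≤ c y≤x)) cx≡cy)))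

coprime-* : Coprime a m → Coprime b m → Coprime (a * b) m
coprime-* {a = a} a⊥m b⊥m {i} (i∣ab , i∣m) = b⊥m (coprime-divisor i⊥a i∣ab , i∣m)
  where
  i⊥a : Coprime i a
  i⊥a (j∣i , j∣a) = a⊥m (j∣a , ∣-trans j∣i i∣m)

coprime-^ : Coprime a m → ∀ e → Coprime (a ^ e) m
coprime-^ {m = m} a⊥m zero    = Coprimality.1-coprimeTo m
coprime-^         a⊥m (suc e) = coprime-* a⊥m (coprime-^ a⊥m e)

coprime-*⇒coprimeʳ : Coprime (a * b) m → Coprime b m
coprime-*⇒coprimeʳ {a = a} ab⊥m (i∣b , i∣m) = ab⊥m (∣n⇒∣m*n a i∣b , i∣m)

coprime-∣ʳ : d ∣ m → Coprime a m → Coprime a d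
coprime-∣ʳ d∣m a⊥m (i∣a , i∣d) = a⊥m (i∣a , ∣-trans i∣d d∣m)

coprime-% : .{{_ : NonZero m}} → Coprime x m ⇔ Coprime (x % m) m
coprime-% {m = m@(suc _)} {x = x} = mk⇔ to from
  where
  to : Coprime x m → Coprime (x % m) m
  to x⊥m (i∣x%m , i∣m) = x⊥m (∣n∣m%n⇒∣m i∣m i∣x%m , i∣m)
  from : Coprime (x % m) m → Coprime x m
  from x%m⊥m (i∣x , i∣m) = x%m⊥m (%-presˡ-∣ i∣x i∣m , i∣m)

coprime-inverse : .{{_ : NonZero m}} → Coprime x m → ∃ λ y → x * y ≡ 1 modulo m
coprime-inverse {m = suc k} {x = x} x⊥m with coprime-Bézout x⊥m
... | GCD.Bézout.+- p q eq = p , 0 , q , trans (+-identityʳ (x * p)) (trans (*-comm x p) (sym eq))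
-- here p x ≡ −1, so x (k p) ≡ −k ≡ 1
... | GCD.Bézout.-+ p q eq = k * p , 1 , k * q , (begin
  x * (k * p) + 1 * suc k  ≡⟨ solve (x ∷ p ∷ k ∷ []) ⟩
  k * (1 + p * x) + 1      ≡⟨ cong (λ t → k * t + 1) eq ⟩
  k * (q * suc k) + 1      ≡⟨ solve (k ∷ q ∷ []) ⟩
  1 + k * q * suc k        ∎)
  where open ≡-Reasoning

leastBelow-minimal : ∀ b (p : ℕ → Bool) {i} → i < leastBelow b p → ¬ T (p i)
leastBelow-minimal (suc b) p {i} i<l with p zero in p0
leastBelow-minimal (suc b) p {zero}  i<l | false = λ p0′ → subst T p0 p0′
leastBelow-minimal (suc b) p {suc i} i<l | false = leastBelow-minimal b (p ∘ suc) (s<s⁻¹ i<l)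

leastBelow-found : ∀ b (p : ℕ → Bool) {j} → j < b → T (p j) → T (p (leastBelow b p))
leastBelow-found (suc b) p {j}     j<b pj with p zero in p0
leastBelow-found (suc b) p {j}     j<b pj | true  = subst T (sym p0) _
leastBelow-found (suc b) p {zero}  j<b pj | false = ⊥-elim (subst T p0 pj)
leastBelow-found (suc b) p {suc j} j<b pj | false = leastBelow-found b (p ∘ suc) (s<s⁻¹ j<b) pj

leastBelow-zero : ∀ b (p : ℕ → Bool) → T (p 0) → leastBelow (suc b) p ≡ 0
leastBelow-zero b p p0 with p zero
... | true = refl

leastBelow-≤ : ∀ b (p : ℕ → Bool) {j} → T (p j) → leastBelow b p ≤ j
leastBelow-≤ b p pj = ≮⇒≥ (λ j<l → leastBelow-minimal b p j<l pj)

module _ {P : ℕ → Set} where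

  least : Decidable P → P b → ∃ (IsLeast P)
  least {b} P? Pb = leastBelow (suc b) p
                  , toWitness (leastBelow-found (suc b) p ≤-refl (fromWitness Pb))
                  , λ k Pk → leastBelow-≤ (suc b) p (fromWitness Pk)
    where
    p : ℕ → Bool
    p = isYes ∘ P?

  IsLeast-resp-⇔ : ∀ {Q : ℕ → Set} → (∀ ν → P ν ⇔ Q ν) → IsLeast P t → IsLeast Q t
  IsLeast-resp-⇔ P⇔Q (Pt , t-min) =
    Equivalence.to (P⇔Q _) Pt , λ k Qk → t-min k (Equivalence.from (P⇔Q k) Qk)

  IsLeast-pred : ∀ {Q : ℕ → Set} → (P 0 → Q 0) → (∀ ν → P (suc ν) ⇔ Q ν) →
                 IsLeast P t → IsLeast Q (t ∸ 1)
  IsLeast-pred {zero}  P0⇒Q0 P∘suc⇔Q (Pt , t-min) = P0⇒Q0 Pt , λ _ _ → z≤n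
  IsLeast-pred {suc t} P0⇒Q0 P∘suc⇔Q (Pt , t-min) =
    Equivalence.to (P∘suc⇔Q t) Pt ,
    λ k Qk → ∸-monoˡ-≤ 1 (t-min (suc k) (Equivalence.from (P∘suc⇔Q k) Qk))

-- Euler's theorem

∏-* : (f g : Fin n → ℕ) → ∏ (λ i → f i * g i) ≡ ∏ f * ∏ g
∏-* {zero}  f g = refl
∏-* {suc n} f g = trans (cong (f Fin.zero * g Fin.zero *_) (∏-* (f ∘ Fin.suc) (g ∘ Fin.suc)))
  ([m*n]*[o*p]≡[m*o]*[n*p] (f Fin.zero) (g Fin.zero) (∏ (f ∘ Fin.suc)) (∏ (g ∘ Fin.suc)))

∏-^ : ∀ x (f : Fin n → ℕ) → ∏ (λ i → x ^ f i) ≡ x ^ ∑ f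
∏-^ {zero}  x f = refl
∏-^ {suc n} x f = trans (cong (x ^ f Fin.zero *_) (∏-^ x (f ∘ Fin.suc)))
  (sym (^-distribˡ-+-* x (f Fin.zero) (∑ (f ∘ Fin.suc))))

∏-cong-mod : (f g : Fin n → ℕ) → (∀ i → f i ≡ g i modulo m) → ∏ f ≡ ∏ g modulo m
∏-cong-mod {zero}  f g f≡g = mod-refl
∏-cong-mod {suc n} f g f≡g =
  *-cong-mod (f≡g Fin.zero) (∏-cong-mod (f ∘ Fin.suc) (g ∘ Fin.suc) (f≡g ∘ Fin.suc))

∏-coprime : (f : Fin n → ℕ) → (∀ i → Coprime (f i) m) → Coprime (∏ f) m
∏-coprime {zero}  {m} f f⊥m = Coprimality.1-coprimeTo m
∏-coprime {suc n}     f f⊥m = coprime-* (f⊥m Fin.zero) (∏-coprime (f ∘ Fin.suc) (f⊥m ∘ Fin.suc))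

∑-≤ : (f : Fin n → ℕ) → (∀ i → f i ≤ 1) → ∑ f ≤ n
∑-≤ {zero}  f f≤1 = z≤n
∑-≤ {suc n} f f≤1 = +-mono-≤ (f≤1 Fin.zero) (∑-≤ (f ∘ Fin.suc) (f≤1 ∘ Fin.suc))

iverson : ∀ {P : Set} → Dec P → ℕ
iverson (yes _) = 1
iverson (no _)  = 0

iverson≤1 : ∀ {P : Set} (P? : Dec P) → iverson P? ≤ 1
iverson≤1 (yes _) = ≤-refl
iverson≤1 (no _)  = z≤n

isUnit? : (i : Fin m) → Dec (Coprime (toℕ i) m)
isUnit? {m} i = coprime? (toℕ i) m

φ : ℕ → ℕ
φ m = ∑ (λ (i : Fin m) → iverson (isUnit? i))

φ-bounds : ∀ k → ∃ λ j → φ (2 + k) ≡ suc j × j ≤ k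
φ-bounds k with isUnit? {2 + k} Fin.zero | isUnit? {2 + k} (Fin.suc Fin.zero)
... | yes 0⊥m | _       = ⊥-elim (Coprimality.¬0-coprimeTo-2+ 0⊥m)
... | no _    | no ¬1⊥m = ⊥-elim (¬1⊥m (Coprimality.1-coprimeTo (2 + k)))
... | no _    | yes _   = _ , refl , ∑-≤ _ (iverson≤1 ∘ isUnit? ∘ Fin.suc ∘ Fin.suc)

-- Multiplication by x permutes the residues modulo m and maps units to units, so the
-- product of all units is unchanged, while it acquires a factor x for every unit.
module _ {m x : ℕ} .{{_ : NonZero m}} (x⊥m : Coprime x m) where

  private
    mul : ℕ → Fin m → Fin m
    mul y i = fromℕ< (m%n<n (y * toℕ i) m)

    toℕ-mul : ∀ y i → toℕ (mul y i) ≡ y * toℕ i % m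
    toℕ-mul y i = toℕ-fromℕ< (m%n<n (y * toℕ i) m)

    mul-inverse : y * z ≡ 1 modulo m → ∀ i → mul y (mul z i) ≡ i
    mul-inverse {y} {z} yz≡1 i = toℕ-injective (mod-<⇒≡ (toℕ<n _) (toℕ<n i) (begin
      toℕ (mul y (mul z i))  ≡⟨ toℕ-mul y (mul z i) ⟩
      y * toℕ (mul z i) % m  ≈⟨ %-mod _ m ⟩
      y * toℕ (mul z i)      ≡⟨ cong (y *_) (toℕ-mul z i) ⟩
      y * (z * toℕ i % m)    ≈⟨ *-cong-mod (mod-refl {x = y}) (%-mod _ m) ⟩
      y * (z * toℕ i)        ≡⟨ *-assoc y z (toℕ i) ⟨
      y * z * toℕ i          ≈⟨ *-cong-mod yz≡1 mod-refl ⟩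
      1 * toℕ i              ≡⟨ *-identityˡ (toℕ i) ⟩
      toℕ i                  ∎))
      where open import Relation.Binary.Reasoning.Setoid (modulo-setoid m)

    x⁻¹ : ℕ
    x⁻¹ = proj₁ (coprime-inverse x⊥m)

    multiplication-by-x : Permutation m m
    multiplication-by-x = permutation (mul x) (mul x⁻¹)
      (mul-inverse {x} {x⁻¹} (proj₂ (coprime-inverse x⊥m)))
      (mul-inverse {x⁻¹} {x} (mod-trans (≡⇒mod (*-comm x⁻¹ x)) (proj₂ (coprime-inverse x⊥m))))

    isUnit-mul : ∀ i → Coprime (toℕ (mul x i)) m ⇔ Coprime (toℕ i) m
    isUnit-mul i rewrite toℕ-mul x i = mk⇔ to from
      where
      to : Coprime (x * toℕ i % m) m → Coprime (toℕ i) m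
      to xi⊥m = coprime-*⇒coprimeʳ {a = x} (Equivalence.from coprime-% xi⊥m)
      from : Coprime (toℕ i) m → Coprime (x * toℕ i % m) m
      from i⊥m = Equivalence.to coprime-% (coprime-* x⊥m i⊥m)

    unitIndicator : Fin m → ℕ
    unitIndicator i = iverson (isUnit? i)

    unitPart : Fin m → ℕ
    unitPart i = toℕ i ^ unitIndicator i

    unitPart-coprime : ∀ i → Coprime (unitPart i) m
    unitPart-coprime i with isUnit? i
    ... | yes i⊥m = coprime-^ i⊥m 1
    ... | no _    = Coprimality.1-coprimeTo m

    unitPart-mul : ∀ i → unitPart (mul x i) ≡ x ^ unitIndicator i * unitPart i modulo m
    unitPart-mul i with isUnit? i | isUnit? (mul x i)
    ... | yes _   | yes _    = begin
      toℕ (mul x i) * 1    ≡⟨ *-identityʳ _ ⟩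
      toℕ (mul x i)        ≡⟨ toℕ-mul x i ⟩
      x * toℕ i % m        ≈⟨ %-mod _ m ⟩
      x * toℕ i            ≡⟨ cong₂ _*_ (*-identityʳ x) (*-identityʳ (toℕ i)) ⟨
      x * 1 * (toℕ i * 1)  ∎
      where open import Relation.Binary.Reasoning.Setoid (modulo-setoid m)
    ... | yes i⊥m | no ¬xi⊥m = ⊥-elim (¬xi⊥m (Equivalence.from (isUnit-mul i) i⊥m))
    ... | no ¬i⊥m | yes xi⊥m = ⊥-elim (¬i⊥m (Equivalence.to (isUnit-mul i) xi⊥m))
    ... | no _    | no _     = mod-refl

  euler : x ^ φ m ≡ 1 modulo m
  euler = *-cancelˡ-mod (Coprimality.sym (∏-coprime unitPart unitPart-coprime)) (begin
    ∏ unitPart * x ^ φ m                        ≡⟨ *-comm (∏ unitPart) _ ⟩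
    x ^ φ m * ∏ unitPart                        ≡⟨⟩
    x ^ ∑ unitIndicator * ∏ unitPart            ≡⟨ cong (_* ∏ unitPart) (∏-^ x unitIndicator) ⟨
    ∏ (λ i → x ^ unitIndicator i) * ∏ unitPart  ≡⟨ ∏-* (λ i → x ^ unitIndicator i) unitPart ⟨
    ∏ (λ i → x ^ unitIndicator i * unitPart i)  ≈⟨ ∏-cong-mod (unitPart ∘ mul x) _ unitPart-mul ⟨
    ∏ (unitPart ∘ mul x)                        ≡⟨ sum-permute unitPart multiplication-by-x ⟨
    ∏ unitPart                                  ≡⟨ *-identityʳ _ ⟨
    ∏ unitPart * 1                              ∎)
    where open import Relation.Binary.Reasoning.Setoid (modulo-setoid m)

-- Universal exponents and Carmichael's function

T-all-upTo : ∀ (p : ℕ → Bool) n → T (all p (upTo n)) ⇔ (∀ {i} → i < n → T (p i))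
T-all-upTo p n = mk⇔ to from
  where
  to : T (all p (upTo n)) → ∀ {i} → i < n → T (p i)
  to h i<n = All.lookup (all⁺ p (upTo n) h) (∈-upTo⁺ i<n)
  from : (∀ {i} → i < n → T (p i)) → T (all p (upTo n))
  from h = all⁻ p (All.tabulate (h ∘ ∈-upTo⁻))

T-not-∨ : ∀ {b c} → T (not b ∨ c) ⇔ (T b → T c)
T-not-∨ {true}  = mk⇔ (λ c _ → c) (λ h → h _)
T-not-∨ {false} = mk⇔ (λ _ ()) _

IsUniversalExponent : ℕ → ℕ → Set
IsUniversalExponent m e = ∀ a → Coprime a m → a ^ e ≡ 1 modulo m

carmichaelExp?-correct : .{{_ : NonZero m}} → T (carmichaelExp? m e) ⇔ IsUniversalExponent m e
carmichaelExp?-correct {m = m@(suc _)} {e} = mk⇔ to from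
  where
  to : T (carmichaelExp? m e) → IsUniversalExponent m e
  to h a a⊥m = mod-trans (^-congˡ-mod (mod-sym (%-mod a m)) e)
    (%≡⇒mod (≡ᵇ⇒≡ _ _ (Equivalence.to T-not-∨ (Equivalence.to (T-all-upTo _ m) h (m%n<n a m))
      (≡⇒≡ᵇ _ _ (coprime⇒gcd≡1 (Equivalence.to coprime-% a⊥m))))))
  from : IsUniversalExponent m e → T (carmichaelExp? m e)
  from h = Equivalence.from (T-all-upTo _ m) λ {r} _ → Equivalence.from T-not-∨ λ gcd≡1 →
    ≡⇒≡ᵇ _ _ (mod⇒%≡ (h r (gcd≡1⇒coprime (≡ᵇ⇒≡ _ _ gcd≡1))))

eulerExponent : ∀ k → ∃ λ j → j ≤ k × IsUniversalExponent (2 + k) (suc j)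
eulerExponent k =
  let j , φ≡1+j , j≤k = φ-bounds k in
  j , j≤k , subst (IsUniversalExponent (2 + k)) φ≡1+j (λ _ → euler)

universalExponent : ∀ k → ∃ λ j → j < suc k × IsUniversalExponent (suc k) (suc j)
universalExponent zero    = 0 , z<s , λ _ _ → modulo-1
universalExponent (suc k) = let j , j≤k , univ = eulerExponent k in j , s≤s (m≤n⇒m≤1+n j≤k) , univ

carmichael-≤ : IsUniversalExponent (suc k) (suc j) → carmichael (suc k) ≤ suc j
carmichael-≤ {k} {j} univ = s≤s (leastBelow-≤ (suc k) (λ i → carmichaelExp? (suc k) (suc i))
  (Equivalence.from (carmichaelExp?-correct {suc k} {suc j}) univ))

carmichael-universal : ∀ k → IsUniversalExponent (suc k) (carmichael (suc k))
carmichael-universal k =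
  let j , j<m , univ = universalExponent k in
  Equivalence.to (carmichaelExp?-correct {suc k} {carmichael (suc k)})
    (leastBelow-found (suc k) (λ i → carmichaelExp? (suc k) (suc i)) j<m
      (Equivalence.from (carmichaelExp?-correct {suc k} {suc j}) univ))

carmichael-one : carmichael 1 ≡ 1
carmichael-one = ≤-antisym (carmichael-≤ {0} {0} (λ _ _ → modulo-1)) (s≤s z≤n)

carmichael-< : carmichael (2 + k) < 2 + k
carmichael-< {k} = let j , j≤k , univ = eulerExponent k in s≤s (≤-trans (carmichael-≤ univ) (s≤s j≤k))

carmichael-nonZero : .{{_ : NonZero m}} → NonZero (carmichael m)
carmichael-nonZero {suc k} = _

carmichael≡1⊎< : .{{_ : NonZero m}} → carmichael m ≡ 1 ⊎ carmichael m < m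
carmichael≡1⊎< {suc zero}    = inj₁ carmichael-one
carmichael≡1⊎< {suc (suc k)} = inj₂ carmichael-<

-- Multiplicative orders

ord-pow≡1 : .{{_ : NonZero m}} → Coprime a m → a ^ ord m a ≡ 1 modulo m
ord-pow≡1 {m = suc k} {a} a⊥m =
  let j , j<m , univ = universalExponent k in
  %≡⇒mod (≡ᵇ⇒≡ _ _ (leastBelow-found (suc k) (λ i → a ^ suc i % suc k ≡ᵇ 1 % suc k) j<m
    (≡⇒≡ᵇ _ _ (mod⇒%≡ (univ a a⊥m)))))

ord-minimal : .{{_ : NonZero m}} → 0 < e → e < ord m a → ¬ (a ^ e ≡ 1 modulo m)
ord-minimal {m = suc k} {e = suc i} {a} _ (s≤s i<l) a^e≡1 =
  leastBelow-minimal (suc k) (λ i → a ^ suc i % suc k ≡ᵇ 1 % suc k) i<l (≡⇒≡ᵇ _ _ (mod⇒%≡ a^e≡1))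

instance
  ord-nonZero : .{{_ : NonZero m}} → NonZero (ord m a)
  ord-nonZero {m = suc k} = _

module _ {m a : ℕ} .{{_ : NonZero m}} (a⊥m : Coprime a m) where

  ^-+-*ord : ∀ x q → a ^ (x + q * ord m a) ≡ a ^ x modulo m
  ^-+-*ord x q = begin
    a ^ (x + q * o)      ≡⟨ ^-distribˡ-+-* a x (q * o) ⟩
    a ^ x * a ^ (q * o)  ≡⟨ cong (λ t → a ^ x * a ^ t) (*-comm q o) ⟩
    a ^ x * a ^ (o * q)  ≡⟨ cong (a ^ x *_) (^-*-assoc a o q) ⟨
    a ^ x * (a ^ o) ^ q  ≈⟨ *-cong-mod (mod-refl {x = a ^ x}) (^-congˡ-mod (ord-pow≡1 a⊥m) q) ⟩
    a ^ x * 1 ^ q        ≡⟨ cong (a ^ x *_) (^-zeroˡ q) ⟩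
    a ^ x * 1            ≡⟨ *-identityʳ (a ^ x) ⟩
    a ^ x                ∎
    where
    o : ℕ
    o = ord m a
    open import Relation.Binary.Reasoning.Setoid (modulo-setoid m)

  ord-∣ : a ^ e ≡ 1 modulo m → ord m a ∣ e
  ord-∣ {e} a^e≡1 = m%n≡0⇒n∣m e o (n≤0⇒n≡0 (≮⇒≥ λ 0<r → ord-minimal 0<r (m%n<n e o) a^r≡1))
    where
    o : ℕ
    o = ord m a
    a^r≡1 : a ^ (e % o) ≡ 1 modulo m
    a^r≡1 = mod-trans (mod-sym (^-+-*ord (e % o) (e / o)))
              (mod-trans (≡⇒mod (cong (a ^_) (sym (m≡m%n+[m/n]*n e o)))) a^e≡1)

  ^-cong-ord : x ≡ y modulo ord m a ⇔ a ^ x ≡ a ^ y modulo m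
  ^-cong-ord = mk⇔ to (mod-wlog-≤ (λ x y → a ^ x ≡ a ^ y modulo m) mod-sym from)
    where
    to : x ≡ y modulo ord m a → a ^ x ≡ a ^ y modulo m
    to {x} {y} (u , v , x+uo≡y+vo) =
      mod-trans (mod-sym (^-+-*ord x u)) (mod-trans (≡⇒mod (cong (a ^_) x+uo≡y+vo)) (^-+-*ord y v))
    from : y ≤ x → a ^ x ≡ a ^ y modulo m → x ≡ y modulo ord m a
    from {y} {x} y≤x a^x≡a^y = Equivalence.from (mod⇔∣∸ y≤x)
      (ord-∣ (*-cancelˡ-mod (Coprimality.sym (coprime-^ a⊥m y)) (begin
        a ^ y * a ^ (x ∸ y)  ≡⟨ ^-distribˡ-+-* a y (x ∸ y) ⟨
        a ^ (y + (x ∸ y))    ≡⟨ cong (a ^_) (m+[n∸m]≡n y≤x) ⟩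
        a ^ x                ≈⟨ a^x≡a^y ⟩
        a ^ y                ≡⟨ *-identityʳ (a ^ y) ⟨
        a ^ y * 1            ∎)))
      where open import Relation.Binary.Reasoning.Setoid (modulo-setoid m)

  ord≡1⇔ : (ord m a ≡ 1) ⇔ (a ≡ 1 modulo m)
  ord≡1⇔ = mk⇔ to from
    where
    a≡a^1 : a ≡ a ^ 1 modulo m
    a≡a^1 = ≡⇒mod (sym (*-identityʳ a))
    to : ord m a ≡ 1 → a ≡ 1 modulo m
    to o≡1 = mod-trans a≡a^1 (subst (λ o → a ^ o ≡ 1 modulo m) o≡1 (ord-pow≡1 a⊥m))
    from : a ≡ 1 modulo m → ord m a ≡ 1
    from a≡1 = ∣1⇒≡1 (ord-∣ (mod-trans (mod-sym a≡a^1) a≡1))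

ord-∣-carmichael : .{{_ : NonZero m}} → Coprime a m → ord m a ∣ carmichael m
ord-∣-carmichael {m = suc k} a⊥m = ord-∣ a⊥m (carmichael-universal k _ a⊥m)

ord-∣-ord : .{{_ : NonZero d}} .{{_ : NonZero m}} → d ∣ m → Coprime a m → ord d a ∣ ord m a
ord-∣-ord d∣m a⊥m = ord-∣ (coprime-∣ʳ d∣m a⊥m) (mod-weaken d∣m (ord-pow≡1 a⊥m))

-- Iterates of Carmichael's function

V-coprime : Coprime m a → V a m ≡ m
V-coprime {zero}      _   = refl
V-coprime {suc k} {a} m⊥a = cong (suc k ∸_) (leastBelow-zero k
  (λ i → does ((suc k ∸ i) ∣? suc k) ∧ (gcd (suc k ∸ i) a ≡ᵇ 1))
  (Equivalence.from T-∧ (Equivalence.from T-≡ (dec-true (suc k ∣? suc k) ∣-refl) ,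
                         ≡⇒≡ᵇ _ _ (coprime⇒gcd≡1 m⊥a))))

∈⇒∣-foldr-lcm : ∀ {xs} → x ∈ xs → x ∣ foldr lcm 1 xs
∈⇒∣-foldr-lcm {xs = y ∷ ys} (here refl)  = m∣lcm[m,n] y (foldr lcm 1 ys)
∈⇒∣-foldr-lcm {xs = y ∷ ys} (there x∈ys) = ∣-trans (∈⇒∣-foldr-lcm x∈ys) (n∣lcm[m,n] y (foldr lcm 1 ys))

∣-nonZero : .{{_ : NonZero m}} → d ∣ m → NonZero d
∣-nonZero {m} {zero}  0∣m = contradiction (0∣⇒≡0 0∣m) (≢-nonZero⁻¹ m)
∣-nonZero {m} {suc d} _   = _

module _ {n : ℕ} .{{_ : NonZero n}} where

  iter-carmichael-nonZero : ∀ k → NonZero (iter carmichael k n)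
  iter-carmichael-nonZero zero    = >-nonZero (>-nonZero⁻¹ n)
  iter-carmichael-nonZero (suc k) = carmichael-nonZero {{iter-carmichael-nonZero k}}

  iter-carmichael-descends : ∀ k → iter carmichael k n ≡ 1 ⊎ iter carmichael k n + k ≤ n
  iter-carmichael-descends zero    = inj₂ (≤-reflexive (+-identityʳ n))
  iter-carmichael-descends (suc k) =
    step (iter-carmichael-descends k) (carmichael≡1⊎< {{iter-carmichael-nonZero k}})
    where
    Λ : ℕ
    Λ = iter carmichael k n
    step : Λ ≡ 1 ⊎ Λ + k ≤ n → carmichael Λ ≡ 1 ⊎ carmichael Λ < Λ →
           carmichael Λ ≡ 1 ⊎ carmichael Λ + suc k ≤ n
    step (inj₁ Λ≡1)   _             = inj₁ (trans (cong carmichael Λ≡1) carmichael-one)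
    step (inj₂ _)     (inj₁ λ[Λ]≡1) = inj₁ λ[Λ]≡1
    step (inj₂ Λ+k≤n) (inj₂ λ[Λ]<Λ) =
      inj₂ (≤-trans (≤-reflexive (+-suc _ k)) (≤-trans (+-monoˡ-≤ k λ[Λ]<Λ) Λ+k≤n))

  iter-carmichael-H : iter carmichael (H n) n ≡ 1
  iter-carmichael-H = ≡ᵇ⇒≡ _ _ (leastBelow-found (suc n) (λ α → iter carmichael α n ≡ᵇ 1) (n<1+n n)
    (≡⇒≡ᵇ _ _ λⁿ[n]≡1))
    where
    λⁿ[n]≡1 : iter carmichael n n ≡ 1
    λⁿ[n]≡1 with iter-carmichael-descends n
    ... | inj₁ λⁿ[n]≡1   = λⁿ[n]≡1
    ... | inj₂ λⁿ[n]+n≤n = contradiction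
      (≤-trans (+-monoˡ-≤ n (>-nonZero⁻¹ _ {{iter-carmichael-nonZero n}})) λⁿ[n]+n≤n) (<-irrefl refl)

  iter-carmichael-+H : ∀ j → iter carmichael (j + H n) n ≡ 1
  iter-carmichael-+H zero    = iter-carmichael-H
  iter-carmichael-+H (suc j) = trans (cong carmichael (iter-carmichael-+H j)) carmichael-one

  iter-carmichael-∣-L : ∀ k → iter carmichael k n ∣ L n
  iter-carmichael-∣-L k with k ≤? H n
  ... | yes k≤H = ∈⇒∣-foldr-lcm (∈-map⁺ (λ i → iter carmichael i n) (∈-upTo⁺ (s≤s k≤H)))
  ... | no  k≰H = subst (_∣ L n) (sym λᵏ[n]≡1) (1∣ L n)
    where
    λᵏ[n]≡1 : iter carmichael k n ≡ 1
    λᵏ[n]≡1 = trans (cong (λ i → iter carmichael i n) (sym (m∸n+n≡m (≰⇒≥ k≰H)))) (iter-carmichael-+H (k ∸ H n))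

-- Iterated orders and towers

tet-≡1 : a ≡ 1 modulo m → ∀ x → tet a x ≡ 1 modulo m
tet-≡1 a≡1 zero    = mod-refl
tet-≡1 a≡1 (suc x) = mod-trans (^-congˡ-mod a≡1 (tet _ x)) (≡⇒mod (^-zeroˡ (tet _ x)))

module IteratedOrders {n a : ℕ} .{{_ : NonZero n}} (a⊥L : Coprime a (L n)) where

  private
    a⊥λᵏ[n] : ∀ k → Coprime a (iter carmichael k n)
    a⊥λᵏ[n] k = coprime-∣ʳ (iter-carmichael-∣-L k) a⊥L

  ordIt-∣-iter-carmichael : ∀ k → ordIt n a k ∣ iter carmichael k n
  ordIt-nonZero : ∀ k → NonZero (ordIt n a k)
  a⊥ordIt : ∀ k → Coprime a (ordIt n a k)
  ordIt-suc : ∀ k → ordIt n a (suc k) ≡ ord (ordIt n a k) a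

  ordIt-∣-iter-carmichael zero    = ∣-refl
  ordIt-∣-iter-carmichael (suc k) = subst (_∣ iter carmichael (suc k) n) (sym (ordIt-suc k))
    (∣-trans (ord-∣-ord {{ordIt-nonZero k}} {{iter-carmichael-nonZero k}}
                         (ordIt-∣-iter-carmichael k) (a⊥λᵏ[n] k))
             (ord-∣-carmichael {{iter-carmichael-nonZero k}} (a⊥λᵏ[n] k)))
  ordIt-nonZero k = ∣-nonZero {{iter-carmichael-nonZero k}} (ordIt-∣-iter-carmichael k)
  a⊥ordIt k = coprime-∣ʳ (ordIt-∣-iter-carmichael k) (a⊥λᵏ[n] k)
  ordIt-suc k = cong (λ d → ord d a) (V-coprime (Coprimality.sym (a⊥ordIt k)))

  ordIt-H : ordIt n a (H n) ≡ 1
  ordIt-H = ∣1⇒≡1 (subst (ordIt n a (H n) ∣_) iter-carmichael-H (ordIt-∣-iter-carmichael (H n)))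

  ordIt-suc≡1⇔∣ : 1 ≤ a → ∀ ν → (ordIt n a (suc ν) ≡ 1) ⇔ (ordIt n a ν ∣ a ∸ 1)
  ordIt-suc≡1⇔∣ 1≤a ν = subst (λ o → (o ≡ 1) ⇔ (ordIt n a ν ∣ a ∸ 1)) (sym (ordIt-suc ν))
    (mod⇔∣∸ 1≤a ⇔-∘ ord≡1⇔ {{ordIt-nonZero ν}} (a⊥ordIt ν))

  tet-suc-cong : ∀ k → (tet a x ≡ tet a y modulo ordIt n a (suc k)) ⇔
                       (tet a (suc x) ≡ tet a (suc y) modulo ordIt n a k)
  tet-suc-cong {x} {y} k =
    subst (λ o → (tet a x ≡ tet a y modulo o) ⇔ (tet a (suc x) ≡ tet a (suc y) modulo ordIt n a k))
          (sym (ordIt-suc k)) (^-cong-ord {{ordIt-nonZero k}} (a⊥ordIt k))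

  tet-+-cong : ∀ d j → (tet a x ≡ tet a y modulo ordIt n a (d + j)) ⇔
                       (tet a (d + x) ≡ tet a (d + y) modulo ordIt n a j)
  tet-+-cong         zero    j = ⇔-id _
  tet-+-cong {x} {y} (suc d) j =
    tet-suc-cong {d + x} {d + y} j ⇔-∘ (tet-+-cong {x} {y} d (suc j) ⇔-∘ reindex)
    where
    Cong : ℕ → Set
    Cong i = tet a x ≡ tet a y modulo ordIt n a i
    reindex : Cong (suc d + j) ⇔ Cong (d + suc j)
    reindex = subst (λ i → Cong (suc d + j) ⇔ Cong i) (sym (+-suc d j)) (⇔-id _)

  tet-lift : ∀ t → (tet a x ≡ tet a y modulo ordIt n a t) ⇔ (tet a (t + x) ≡ tet a (t + y) modulo n)
  tet-lift {x} {y} t =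
    subst (λ i → (tet a x ≡ tet a y modulo ordIt n a i) ⇔ (tet a (t + x) ≡ tet a (t + y) modulo n))
          (+-identityʳ t) (tet-+-cong t 0)

  LevProp⇔∣ : 1 ≤ a → ∀ t → LevProp n a t ⇔ (ordIt n a t ∣ a ∸ 1)
  LevProp⇔∣ 1≤a t = mk⇔ to from
    where
    open ≡-Reasoning
    a≡1⇔∣ : (a ≡ 1 modulo ordIt n a t) ⇔ (ordIt n a t ∣ a ∸ 1)
    a≡1⇔∣ = mod⇔∣∸ 1≤a
    to : LevProp n a t → ordIt n a t ∣ a ∸ 1
    to lev = Equivalence.to a≡1⇔∣ (mod-trans (≡⇒mod (sym (*-identityʳ a)))
      (Equivalence.from (tet-lift {1} {0} t) (%≡⇒mod (begin
        tet a (t + 1) % n  ≡⟨ lev (t + 1) (m≤m+n t 1) ⟩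
        tet a t % n        ≡⟨ cong (λ i → tet a i % n) (+-identityʳ t) ⟨
        tet a (t + 0) % n  ∎))))
    from : ordIt n a t ∣ a ∸ 1 → LevProp n a t
    from o∣a∸1 k t≤k = begin
      tet a k % n              ≡⟨ cong (λ i → tet a i % n) (m+[n∸m]≡n t≤k) ⟨
      tet a (t + (k ∸ t)) % n  ≡⟨ mod⇒%≡ (Equivalence.to (tet-lift t) tet-k∸t≡tet-0) ⟩
      tet a (t + 0) % n        ≡⟨ cong (λ i → tet a i % n) (+-identityʳ t) ⟩
      tet a t % n              ∎
      where
      a≡1 : a ≡ 1 modulo ordIt n a t
      a≡1 = Equivalence.from a≡1⇔∣ o∣a∸1
      tet-k∸t≡tet-0 : tet a (k ∸ t) ≡ tet a 0 modulo ordIt n a t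
      tet-k∸t≡tet-0 = mod-trans (tet-≡1 a≡1 (k ∸ t)) (mod-sym (tet-≡1 a≡1 0))

corollary5p5 : (n a : ℕ) .{{_ : NonZero n}} → 1 ≤ a → gcd a (L n) ≡ 1 →
    ∃[ μ ] (IsLeast (λ ν → ordIt n a ν ≡ 1) μ
           × IsLeast (LevProp n a) (μ ∸ 1)
           × IsLeast (λ ν → ordIt n a ν ∣ a ∸ 1) (μ ∸ 1))
corollary5p5 n a 1≤a gcd[a,Ln]≡1 =
  μ , μ-least , IsLeast-resp-⇔ (λ t → ⇔-sym (LevProp⇔∣ 1≤a t)) ∣-least , ∣-least
  where
  open IteratedOrders {n} {a} (gcd≡1⇒coprime gcd[a,Ln]≡1)
  μ-exists : ∃ (IsLeast (λ ν → ordIt n a ν ≡ 1))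
  μ-exists = least {b = H n} (λ ν → ordIt n a ν ≟ 1) ordIt-H
  μ : ℕ
  μ = proj₁ μ-exists
  μ-least : IsLeast (λ ν → ordIt n a ν ≡ 1) μ
  μ-least = proj₂ μ-exists
  ∣-least : IsLeast (λ ν → ordIt n a ν ∣ a ∸ 1) (μ ∸ 1)
  ∣-least = IsLeast-pred (λ n≡1 → subst (_∣ a ∸ 1) (sym n≡1) (1∣ (a ∸ 1))) (ordIt-suc≡1⇔∣ 1≤a) μ-least
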